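{- Let $h\colon[n]\to[n]$ be a Hessenberg function and $w\in\mathfrak S_n$ a generator for $h$. Let $u,v\in[w,w_0]$ satisfy $v=u(a,b)$ for some $(a,b)\in E_{w,h}(u)$ and $u\prec_h v$. Then the map $\phi_{uv}\colon E_{w,h}(u)\to E_{w,h}(v)$ is well-defined (i.e., takes values in $E_{w,h}(v)$) and injective.
   Context: A Hessenberg function is a nondecreasing $h\colon[n]\to[n]$ with $h(i)\ge i$. Permutations are in one-line notation; $u(i,j)$ swaps the entries in positions $i,j$; $\ell(u)$ is the number of inversions. The Bruhat order $\preceq$ is the reflexive–transitive closure of $u\prec u(i,j)$ when $\ell(u(i,j))>\ell(u)$; $w_0=n(n-1)\cdots1$, $[w,w_0]=\{u\mid w\preceq u\preceq w_0\}$. The $h$-Bruhat order is the transitive closure of $u\prec_h u(i,j)$ when $i<j\le h(i)$ and $\ell(u(i,j))>\ell(u)$. A generator for $h$ is a $w$ with $w^{ -1}(w(i)+1)\le h(i)$ whenever $w(i)\le n-1$. For $u\in[w,w_0]$, $E_{w,h}(u)=\{(i,j)\mid 1\le i<j\le h(i),\ u(i,j)\succeq w\}$. The map $\phi_{uv}$ sends $(i,j)\in E_{w,h}(u)$ to $(\overline i,\overline j)$, where $(\overline i,\overline j)=(b,j)$ if $i=a$, $j>b$ and $(b,j)\notin E_{w,h}(u)$; $(\overline i,\overline j)=(i,a)$ if $i<a$, $j=b$ and $(i,a)\notin E_{w,h}(u)$; and $(\overline i,\overline j)=(i,j)$ otherwise. -}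

module Defs where

open import Data.Nat using (ℕ; suc)
open import Data.Fin using (Fin; toℕ; _<_; _≤_; _<?_)
open import Data.Fin.Permutation
  using (Permutation′; _⟨$⟩ʳ_; _⟨$⟩ˡ_; _∘ₚ_; transpose; reverse; _≈_)
open import Data.List using (List; length; filter; cartesianProduct; allFin)
open import Data.Product using (_×_; _,_; Σ-syntax; ∃-syntax)
open import Relation.Nullary using (¬_)
open import Relation.Nullary.Decidable using (_×-dec_)
open import Relation.Binary.PropositionalEquality using (_≡_)
import Data.Nat as ℕ

-- Positions and values are 0-indexed: [n] is represented by Fin n.

record IsHessenberg {n : ℕ} (h : Fin n → Fin n) : Set where
  field
    monotone : ∀ {i j} → i ≤ j → h i ≤ h j
    extensive : ∀ i → i ≤ h i

Perm : ℕ → Set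
Perm = Permutation′

-- u(i,j): swap the entries in positions i and j (one-line notation),
-- i.e. u(i,j)(k) = u(t_{ij}(k)).
swapPos : ∀ {n} → Perm n → Fin n → Fin n → Perm n
swapPos u i j = transpose i j ∘ₚ u

len : ∀ {n} → Perm n → ℕ
len {n} u = length (filter (λ p → (Data.Product.proj₁ p <? Data.Product.proj₂ p)
                                   ×-dec (u ⟨$⟩ʳ Data.Product.proj₂ p <? u ⟨$⟩ʳ Data.Product.proj₁ p))
                           (cartesianProduct (allFin n) (allFin n)))

w₀ : ∀ {n} → Perm n
w₀ = reverse

BruhatStep : ∀ {n} → Perm n → Perm n → Set
BruhatStep u v = ∃[ i ] ∃[ j ] (i < j × v ≈ swapPos u i j × len u ℕ.< len v)

data _≼_ {n : ℕ} : Perm n → Perm n → Set where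
  ≼-refl : ∀ {u v} → u ≈ v → u ≼ v
  ≼-step : ∀ {u v x} → BruhatStep u v → v ≼ x → u ≼ x

InInterval : ∀ {n} → Perm n → Perm n → Set
InInterval w u = w ≼ u × u ≼ w₀

HStep : ∀ {n} → (Fin n → Fin n) → Perm n → Perm n → Set
HStep h u v = ∃[ i ] ∃[ j ] (i < j × j ≤ h i × v ≈ swapPos u i j × len u ℕ.< len v)

data _≺[_]_ {n : ℕ} : Perm n → (Fin n → Fin n) → Perm n → Set where
  ≺-one  : ∀ {h u v} → HStep h u v → u ≺[ h ] v
  ≺-step : ∀ {h u v x} → HStep h u v → v ≺[ h ] x → u ≺[ h ] x

-- w is a generator for h: whenever w(i) is not the largest value,
-- w⁻¹(w(i)+1) ≤ h(i).
IsGenerator : ∀ {n} → (Fin n → Fin n) → Perm n → Set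
IsGenerator h w = ∀ i k → toℕ k ≡ suc (toℕ (w ⟨$⟩ʳ i)) → (w ⟨$⟩ˡ k) ≤ h i

E : ∀ {n} → Perm n → (Fin n → Fin n) → Perm n → Fin n × Fin n → Set
E w h u (i , j) = i < j × j ≤ h i × w ≼ swapPos u i j

-- Graph of φ_{uv} (with v = u(a,b)), given by the three defining cases.
-- Φ w h u a b p q  means  φ_{uv}(p) = q.
data Φ {n : ℕ} (w : Perm n) (h : Fin n → Fin n) (u : Perm n) (a b : Fin n)
       : Fin n × Fin n → Fin n × Fin n → Set where
  case₁ : ∀ {j} → b < j → ¬ E w h u (b , j) → Φ w h u a b (a , j) (b , j)
  case₂ : ∀ {i} → i < a → ¬ E w h u (i , a) → Φ w h u a b (i , b) (i , a)
  case₃ : ∀ {i j} →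
          ¬ (i ≡ a × b < j × ¬ E w h u (b , j)) →
          ¬ (i < a × j ≡ b × ¬ E w h u (i , a)) →
          Φ w h u a b (i , j) (i , j)

module Submission where

-- Swapping the entries in positions i < j raises the
-- number of inversions iff x(i) < x(j), and then it adds 1 to the rank matrix r_x(p, q) = #{k < p | x(k) ≥ q}
-- exactly on the rectangle (i, j] × (x(i), x(j)]; consequently the Bruhat order is the pointwise order of
-- rank matrices.
-- Let v = u(a,b) with u(a) < u(b). For (i, j) ∈ E(u) fixed by φ, v(i,j) = u(i,j)(t(a), t(b)) with
-- t = t_ij, which lies above u(i,j) ≥ w unless t reverses a and b. That happens only for (i, j) equal to
-- (a, b), (a, j > b) or (i < a, b), and the side conditions of φ then put (b, j) resp. (i, a) in E(u) too.
-- These cases, and the pairs moved by φ, are reached by one ascent swap from v or from some u(k,l) ≥ w,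
-- except for a pattern z(p₁) < z(p₂) < z(p₃) with z(p₁,p₂), z(p₂,p₃) ≥ w; then z ≥ w because the
-- rectangles of the two swaps are disjoint. Injectivity is read off the side conditions of φ.

open import Defs
open import Data.Nat as ℕ using (ℕ; zero; suc; _+_; _*_; _∸_; z≤n)
import Data.Nat.Properties as ℕP
open import Data.Nat.Solver using (module +-*-Solver)
open import Data.Nat.Induction using (<-wellFounded)
open import Data.Bool.Base using (true; false; if_then_else_)
open import Data.Fin as Fin using (Fin; toℕ; _<?_)
import Data.Fin.Properties as FinP
open import Data.Fin.Properties using (_≟_)
open import Data.Fin.Permutation using (_≈_; _⟨$⟩ʳ_; _⟨$⟩ˡ_; inverseʳ; inverseˡ)
import Data.Fin.Permutation.Components as PC
open import Data.List.Base using (List; length; filter; cartesianProduct; tabulate; map; _++_)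
import Data.List.Properties as ListP
open import Algebra.Properties.CommutativeMonoid.Sum ℕP.+-0-commutativeMonoid
  using (sum; sum-cong-≗; ∑-distrib-+; ∑-comm; sum-replicate-zero)
open import Algebra.Properties.CommutativeSemigroup ℕP.+-commutativeSemigroup using (x∙yz≈y∙xz)
open import Data.Product using (_×_; _,_; proj₁; proj₂; ∃; ∃-syntax)
open import Data.Sum using (_⊎_; inj₁; inj₂)
open import Function.Base using (_∘_)
open import Function.Definitions using (Injective)
open import Induction.WellFounded using (Acc; acc)
open import Relation.Nullary using (¬_; Dec; yes; no; does; ¬?)
open import Relation.Nullary.Decidable using (_×-dec_; dec-true; dec-false; decidable-stable)
open import Relation.Nullary.Negation using (contradiction)
open import Relation.Unary using (Decidable)
open import Level using (0ℓ)
open import Relation.Binary.Bundles using (Setoid)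
open import Relation.Binary.Definitions using (Tri; tri<; tri≈; tri>)
open import Relation.Binary.PropositionalEquality hiding (J)
import Relation.Binary.Reasoning.Setoid

private
  variable
    n : ℕ

transpose-fst : (i j : Fin n) → PC.transpose i j i ≡ j
transpose-fst i j rewrite dec-true (i ≟ i) refl = refl

transpose-snd : (i j : Fin n) → PC.transpose i j j ≡ i
transpose-snd i j with j ≟ i
... | yes j≡i = j≡i
... | no _ rewrite dec-true (j ≟ j) refl = refl

transpose-other : {i j k : Fin n} → k ≢ i → k ≢ j → PC.transpose i j k ≡ k
transpose-other {i = i} {j} {k} k≢i k≢j rewrite dec-false (k ≟ i) k≢i | dec-false (k ≟ j) k≢j = refl

transpose-sym : (i j k : Fin n) → PC.transpose i j k ≡ PC.transpose j i k
transpose-sym i j k = by-cases (k ≟ i) (k ≟ j)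
  where
  by-cases : Dec (k ≡ i) → Dec (k ≡ j) → PC.transpose i j k ≡ PC.transpose j i k
  by-cases (yes refl) _        = trans (transpose-fst k j) (sym (transpose-snd j k))
  by-cases (no _)     (yes refl) = trans (transpose-snd i k) (sym (transpose-fst k i))
  by-cases (no k≢i)   (no k≢j)   = trans (transpose-other k≢i k≢j) (sym (transpose-other k≢j k≢i))

transpose-involutive : (i j k : Fin n) → PC.transpose i j (PC.transpose i j k) ≡ k
transpose-involutive i j k = trans (cong (PC.transpose i j) (transpose-sym i j k)) (PC.transpose-inverse i j)

transpose-injective : (i j : Fin n) → Injective _≡_ _≡_ (PC.transpose i j)
transpose-injective i j {k} {l} e =
  trans (sym (transpose-involutive i j k)) (trans (cong (PC.transpose i j) e) (transpose-involutive i j l))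

transpose-natural : ∀ {m} (f : Fin n → Fin m) → Injective _≡_ _≡_ f → (i j k : Fin n) →
                    f (PC.transpose i j k) ≡ PC.transpose (f i) (f j) (f k)
transpose-natural f f-inj i j k = by-cases (k ≟ i) (k ≟ j)
  where
  by-cases : Dec (k ≡ i) → Dec (k ≡ j) → f (PC.transpose i j k) ≡ PC.transpose (f i) (f j) (f k)
  by-cases (yes refl) _          = trans (cong f (transpose-fst k j)) (sym (transpose-fst (f k) (f j)))
  by-cases (no _)     (yes refl) = trans (cong f (transpose-snd i k)) (sym (transpose-snd (f i) (f k)))
  by-cases (no k≢i)   (no k≢j)   =
    trans (cong f (transpose-other k≢i k≢j)) (sym (transpose-other (k≢i ∘ f-inj) (k≢j ∘ f-inj)))

<⇒≢ : {i j : Fin n} → i Fin.< j → i ≢ j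
<⇒≢ i<j refl = ℕP.<-irrefl refl i<j

transpose-reverses : {i j a b : Fin n} → i Fin.< j → a Fin.< b → PC.transpose i j b Fin.< PC.transpose i j a →
                     (i ≡ a × j ≡ b) ⊎ (i ≡ a × b Fin.< j) ⊎ (i Fin.< a × j ≡ b)
transpose-reverses {i = i} {j} {a} {b} i<j a<b reversed = by-cases (a ≟ i) (a ≟ j) (b ≟ i) (b ≟ j)
  where
  by-cases : Dec (a ≡ i) → Dec (a ≡ j) → Dec (b ≡ i) → Dec (b ≡ j) →
             (i ≡ a × j ≡ b) ⊎ (i ≡ a × b Fin.< j) ⊎ (i Fin.< a × j ≡ b)
  by-cases (yes refl) _          _          (yes refl) = inj₁ (refl , refl)
  by-cases (yes refl) _          _          (no b≢j)   =
    inj₂ (inj₁ (refl , subst₂ Fin._<_ (transpose-other (<⇒≢ a<b ∘ sym) b≢j) (transpose-fst a j) reversed))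
  by-cases (no a≢i)   (yes refl) _          _          =
    contradiction (subst₂ Fin._<_ (transpose-other (<⇒≢ i<b ∘ sym) (<⇒≢ a<b ∘ sym)) (transpose-snd i a) reversed) (ℕP.<-asym i<b)
    where
    i<b : i Fin.< b
    i<b = ℕP.<-trans i<j a<b
  by-cases (no a≢i)   (no a≢j)   _          (yes refl) =
    inj₂ (inj₂ (subst₂ Fin._<_ (transpose-snd i b) (transpose-other a≢i a≢j) reversed , refl))
  by-cases (no a≢i)   (no a≢j)   (yes refl) (no _)     =
    contradiction (subst₂ Fin._<_ (transpose-fst b j) (transpose-other a≢i a≢j) reversed) (ℕP.<-asym (ℕP.<-trans a<b i<j))
  by-cases (no a≢i)   (no a≢j)   (no b≢i)   (no b≢j)   =
    contradiction (subst₂ Fin._<_ (transpose-other b≢i b≢j) (transpose-other a≢i a≢j) reversed) (ℕP.<-asym a<b)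

⟨$⟩ʳ-injective : (x : Perm n) → Injective _≡_ _≡_ (x ⟨$⟩ʳ_)
⟨$⟩ʳ-injective x {i} {j} xi≡xj = trans (sym (inverseˡ x)) (trans (cong (x ⟨$⟩ˡ_) xi≡xj) (inverseˡ x))

module _ (x : Perm n) where

  swapPos-fst : (i j : Fin n) → swapPos x i j ⟨$⟩ʳ i ≡ x ⟨$⟩ʳ j
  swapPos-fst i j = cong (x ⟨$⟩ʳ_) (transpose-fst i j)

  swapPos-snd : (i j : Fin n) → swapPos x i j ⟨$⟩ʳ j ≡ x ⟨$⟩ʳ i
  swapPos-snd i j = cong (x ⟨$⟩ʳ_) (transpose-snd i j)

  swapPos-other : {i j k : Fin n} → k ≢ i → k ≢ j → swapPos x i j ⟨$⟩ʳ k ≡ x ⟨$⟩ʳ k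
  swapPos-other k≢i k≢j = cong (x ⟨$⟩ʳ_) (transpose-other k≢i k≢j)

  swapPos-sym : (i j : Fin n) → swapPos x i j ≈ swapPos x j i
  swapPos-sym i j k = cong (x ⟨$⟩ʳ_) (transpose-sym i j k)

  swapPos-involutive : (i j : Fin n) → swapPos (swapPos x i j) i j ≈ x
  swapPos-involutive i j k = cong (x ⟨$⟩ʳ_) (transpose-involutive i j k)

  -- With swapPos x a b = x ∘ t_ab these say t_ab t_ij = t_{t_ab(i) t_ab(j)} t_ab = t_ij t_{t_ij(a) t_ij(b)}.
  swapPos-conjugate : ∀ {a b i j i′ j′} → PC.transpose a b i ≡ i′ → PC.transpose a b j ≡ j′ →
                      swapPos (swapPos x a b) i j ≈ swapPos (swapPos x i′ j′) a b
  swapPos-conjugate {a} {b} {i} {j} refl refl k =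
    cong (x ⟨$⟩ʳ_) (transpose-natural (PC.transpose a b) (transpose-injective a b) i j k)

  swapPos-conjugate′ : ∀ {a b i j a′ b′} → PC.transpose i j a ≡ a′ → PC.transpose i j b ≡ b′ →
                       swapPos (swapPos x a b) i j ≈ swapPos (swapPos x i j) a′ b′
  swapPos-conjugate′ {a} {b} {i} {j} refl refl k = cong (x ⟨$⟩ʳ_) (sym (begin
    σ (PC.transpose (σ a) (σ b) k)    ≡⟨ transpose-natural σ (transpose-injective i j) (σ a) (σ b) k ⟩
    PC.transpose (σ (σ a)) (σ (σ b)) (σ k) ≡⟨ cong₂ (λ a′ b′ → PC.transpose a′ b′ (σ k))
                                                  (transpose-involutive i j a) (transpose-involutive i j b) ⟩
    PC.transpose a b (σ k)            ∎))
    where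
    open ≡-Reasoning
    σ : Fin n → Fin n
    σ = PC.transpose i j

swapPos-cong : {x y : Perm n} → x ≈ y → (i j : Fin n) → swapPos x i j ≈ swapPos y i j
swapPos-cong x≈y i j k = x≈y (PC.transpose i j k)

≈-setoid : ℕ → Setoid 0ℓ 0ℓ
≈-setoid n = record
  { Carrier       = Perm n
  ; _≈_           = _≈_
  ; isEquivalence = record
    { refl  = λ _ → refl
    ; sym   = λ x≈y k → sym (x≈y k)
    ; trans = λ x≈y y≈z k → trans (x≈y k) (y≈z k)
    }
  }

module ≈-Reasoning {n} = Relation.Binary.Reasoning.Setoid (≈-setoid n)

indicator : {P : Set} → Dec P → ℕ
indicator P? = if does P? then 1 else 0

module _ {P : Set} (P? : Dec P) where

  indicator-yes : P → indicator P? ≡ 1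
  indicator-yes p rewrite dec-true P? p = refl

  indicator-no : ¬ P → indicator P? ≡ 0
  indicator-no ¬p rewrite dec-false P? ¬p = refl

less : Fin n → Fin n → ℕ
less a b = indicator (a <? b)

indicator-mono : {P Q : Set} (P? : Dec P) (Q? : Dec Q) → (P → Q) → indicator P? ℕ.≤ indicator Q?
indicator-mono (yes p) (no ¬q) P⇒Q = contradiction (P⇒Q p) ¬q
indicator-mono (yes _) (yes _) _   = ℕP.≤-refl
indicator-mono (no _)  _       _   = z≤n

indicator-cong : {P Q : Set} (P? : Dec P) (Q? : Dec Q) → (P → Q) → (Q → P) → indicator P? ≡ indicator Q?
indicator-cong P? Q? P⇒Q Q⇒P = ℕP.≤-antisym (indicator-mono P? Q? P⇒Q) (indicator-mono Q? P? Q⇒P)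

indicator-× : {P Q : Set} (P? : Dec P) (Q? : Dec Q) → indicator (P? ×-dec Q?) ≡ indicator P? * indicator Q?
indicator-× (yes _) (yes _) = refl
indicator-× (yes _) (no _)  = refl
indicator-× (no _)  _       = refl

indicator-split : {P Q R : Set} (P? : Dec P) (Q? : Dec Q) (R? : Dec R) →
                  (Q → P) → (P → ¬ Q → R) → (R → P × ¬ Q) →
                  indicator P? ≡ indicator Q? + indicator R?
indicator-split (yes _) (yes _) (no _)  _   _     _     = refl
indicator-split (yes _) (no _)  (yes _) _   _     _     = refl
indicator-split (no _)  (no _)  (no _)  _   _     _     = refl
indicator-split _       (yes q) (yes r) _   _     R⇒P∖Q = contradiction q (proj₂ (R⇒P∖Q r))
indicator-split (yes p) (no ¬q) (no ¬r) _   P∖Q⇒R _     = contradiction (P∖Q⇒R p ¬q) ¬r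
indicator-split (no ¬p) (yes q) _       Q⇒P _     _     = contradiction (Q⇒P q) ¬p
indicator-split (no ¬p) _       (yes r) _   _     R⇒P∖Q = contradiction (proj₁ (R⇒P∖Q r)) ¬p

sum-mono : {f g : Fin n → ℕ} → (∀ k → f k ℕ.≤ g k) → sum f ℕ.≤ sum g
sum-mono {zero}  _   = z≤n
sum-mono {suc n} f≤g = ℕP.+-mono-≤ (f≤g Fin.zero) (sum-mono (f≤g ∘ Fin.suc))

sum-mono-< : {f g : Fin n → ℕ} → (∀ k → f k ℕ.≤ g k) → (i : Fin n) → f i ℕ.< g i → sum f ℕ.< sum g
sum-mono-< f≤g Fin.zero    fi<gi = ℕP.+-mono-<-≤ fi<gi (sum-mono (f≤g ∘ Fin.suc))
sum-mono-< f≤g (Fin.suc i) fi<gi = ℕP.+-mono-≤-< (f≤g Fin.zero) (sum-mono-< (f≤g ∘ Fin.suc) i fi<gi)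

pointMass : Fin n → ℕ → Fin n → ℕ
pointMass i c k = if does (k ≟ i) then c else 0

sum-pointMass : (i : Fin n) (c : ℕ) → sum (pointMass i c) ≡ c
sum-pointMass {suc n} Fin.zero    c = trans (cong (c +_) (sum-replicate-zero n)) (ℕP.+-identityʳ c)
sum-pointMass {suc n} (Fin.suc i) c = sum-pointMass i c

sum-concentrated : (f : Fin n → ℕ) (i : Fin n) → (∀ k → k ≢ i → f k ≡ 0) → sum f ≡ f i
sum-concentrated f i vanish = trans (sum-cong-≗ f≗δ) (sum-pointMass i (f i))
  where
  f≗δ : ∀ k → f k ≡ pointMass i (f i) k
  f≗δ k with k ≟ i
  ... | yes refl = refl
  ... | no k≢i   = vanish k k≢i

-- sum f − f i − f j ≤ sum g − g i − g j, with the subtractions moved across.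
sum-≤-off₂ : {f g : Fin n → ℕ} {i j : Fin n} → i ≢ j → (∀ k → k ≢ i → k ≢ j → f k ℕ.≤ g k) →
             sum f + (g i + g j) ℕ.≤ sum g + (f i + f j)
sum-≤-off₂ {n} {f} {g} {i} {j} i≢j f≤g = begin
  sum f + (g i + g j) ≡⟨ sum-lift f g ⟨
  sum F               ≤⟨ sum-mono F≤G ⟩
  sum G               ≡⟨ sum-lift g f ⟩
  sum g + (f i + f j) ∎
  where
  open ℕP.≤-Reasoning
  lift : (Fin n → ℕ) → (Fin n → ℕ) → Fin n → ℕ
  lift φ ψ k = φ k + (pointMass i (ψ i) k + pointMass j (ψ j) k)
  F G : Fin n → ℕ
  F = lift f g
  G = lift g f
  sum-lift : ∀ φ ψ → sum (lift φ ψ) ≡ sum φ + (ψ i + ψ j)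
  sum-lift φ ψ = trans (∑-distrib-+ φ _) (cong (sum φ +_) (trans (∑-distrib-+ (pointMass i (ψ i)) (pointMass j (ψ j)))
                                                                 (cong₂ _+_ (sum-pointMass i (ψ i)) (sum-pointMass j (ψ j)))))
  F≤G : ∀ k → F k ℕ.≤ G k
  F≤G k with k ≟ i | k ≟ j
  ... | yes refl | yes refl = contradiction refl i≢j
  ... | yes refl | no _     = ℕP.≤-reflexive (x∙yz≈y∙xz (f k) (g k) 0)
  ... | no _     | yes refl = ℕP.≤-reflexive (ℕP.+-comm (f k) (g k))
  ... | no k≢i   | no k≢j   = ℕP.+-monoˡ-≤ 0 (f≤g k k≢i k≢j)

module _ {f g : Fin n → ℕ} {i j : Fin n} (i≢j : i ≢ j) where

  sum-mono-off₂ : (∀ k → k ≢ i → k ≢ j → f k ℕ.≤ g k) → f i + f j ℕ.≤ g i + g j → sum f ℕ.≤ sum g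
  sum-mono-off₂ f≤g ij≤ = ℕP.+-cancelʳ-≤ (g i + g j) (sum f) (sum g) (begin
    sum f + (g i + g j) ≤⟨ sum-≤-off₂ i≢j f≤g ⟩
    sum g + (f i + f j) ≤⟨ ℕP.+-monoʳ-≤ (sum g) ij≤ ⟩
    sum g + (g i + g j) ∎)
    where open ℕP.≤-Reasoning

  sum-mono-<-off₂ : (∀ k → k ≢ i → k ≢ j → f k ℕ.≤ g k) → f i + f j ℕ.< g i + g j → sum f ℕ.< sum g
  sum-mono-<-off₂ f≤g ij< = ℕP.+-cancelʳ-< (g i + g j) (sum f) (sum g) (begin-strict
    sum f + (g i + g j) ≤⟨ sum-≤-off₂ i≢j f≤g ⟩
    sum g + (f i + f j) <⟨ ℕP.+-monoʳ-< (sum g) ij< ⟩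
    sum g + (g i + g j) ∎)
    where open ℕP.≤-Reasoning

  sum-agree-off₂ : (∀ k → k ≢ i → k ≢ j → f k ≡ g k) → sum g + (f i + f j) ≡ sum f + (g i + g j)
  sum-agree-off₂ f≡g = ℕP.≤-antisym
    (sum-≤-off₂ i≢j (λ k k≢i k≢j → ℕP.≤-reflexive (sym (f≡g k k≢i k≢j))))
    (sum-≤-off₂ i≢j (λ k k≢i k≢j → ℕP.≤-reflexive (f≡g k k≢i k≢j)))

module _ {A : Set} {P : A → Set} (P? : Decidable P) where

  length-filter-tabulate : (f : Fin n → A) → length (filter P? (tabulate f)) ≡ sum (λ k → indicator (P? (f k)))
  length-filter-tabulate {zero}  f = refl
  length-filter-tabulate {suc n} f with does (P? (f Fin.zero))
  ... | true  = cong suc (length-filter-tabulate (f ∘ Fin.suc))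
  ... | false = length-filter-tabulate (f ∘ Fin.suc)

  length-filter-++ : (xs ys : List A) → length (filter P? (xs ++ ys)) ≡ length (filter P? xs) + length (filter P? ys)
  length-filter-++ xs ys = trans (cong length (ListP.filter-++ P? xs ys)) (ListP.length-++ (filter P? xs))

module _ {A B : Set} {P : A × B → Set} (P? : Decidable P) where

  length-filter-cartesianProduct : ∀ {m} (f : Fin n → A) (g : Fin m → B) →
    length (filter P? (cartesianProduct (tabulate f) (tabulate g))) ≡
    sum (λ k → sum (λ l → indicator (P? (f k , g l))))
  length-filter-cartesianProduct {zero}  f g = refl
  length-filter-cartesianProduct {suc n} f g = trans
    (length-filter-++ P? (map (f Fin.zero ,_) (tabulate g)) _)
    (cong₂ _+_ (trans (cong (length ∘ filter P?) (ListP.map-tabulate g (f Fin.zero ,_)))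
                      (length-filter-tabulate P? (λ l → f Fin.zero , g l)))
               (length-filter-cartesianProduct (f ∘ Fin.suc) g))

-- Length as a number of inversions

inversion : Perm n → Fin n → Fin n → ℕ
inversion x p q = indicator ((p <? q) ×-dec (x ⟨$⟩ʳ q <? x ⟨$⟩ʳ p))

len≡∑inversion : (x : Perm n) → len x ≡ sum (λ p → sum (λ q → inversion x p q))
len≡∑inversion x = length-filter-cartesianProduct
  (λ (p , q) → (p <? q) ×-dec (x ⟨$⟩ʳ q <? x ⟨$⟩ʳ p)) (λ k → k) (λ k → k)

len-cong : {x y : Perm n} → x ≈ y → len x ≡ len y
len-cong {x = x} {y} x≈y = begin
  len x                                      ≡⟨ len≡∑inversion x ⟩
  sum (λ p → sum (λ q → inversion x p q))    ≡⟨ sum-cong-≗ (λ p → sum-cong-≗ (λ q →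
                                                  cong₂ (λ xp xq → indicator ((p <? q) ×-dec (xq <? xp))) (x≈y p) (x≈y q))) ⟩
  sum (λ p → sum (λ q → inversion y p q))    ≡⟨ sym (len≡∑inversion y) ⟩
  len y                                      ∎
  where open ≡-Reasoning

discordant : Perm n → Fin n → Fin n → ℕ
discordant x p q = inversion x p q + inversion x q p

module _ (x : Perm n) where

  inversion-ordered : {p q : Fin n} → p Fin.< q → inversion x p q ≡ less (x ⟨$⟩ʳ q) (x ⟨$⟩ʳ p)
  inversion-ordered {p} {q} p<q rewrite dec-true (p <? q) p<q = refl

  inversion-unordered : {p q : Fin n} → ¬ p Fin.< q → inversion x p q ≡ 0
  inversion-unordered {p} {q} p≮q rewrite dec-false (p <? q) p≮q = refl

  discordant-sym : (p q : Fin n) → discordant x p q ≡ discordant x q p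
  discordant-sym p q = ℕP.+-comm (inversion x p q) (inversion x q p)

  discordant-refl : (p : Fin n) → discordant x p p ≡ 0
  discordant-refl p rewrite inversion-unordered {p} {p} (ℕP.<-irrefl refl) = refl

  discordant-< : {p q : Fin n} → p Fin.< q → discordant x p q ≡ less (x ⟨$⟩ʳ q) (x ⟨$⟩ʳ p)
  discordant-< {p} {q} p<q rewrite inversion-ordered p<q | inversion-unordered {q} {p} (ℕP.<-asym p<q) =
    ℕP.+-identityʳ _

  discordant-> : {p q : Fin n} → q Fin.< p → discordant x p q ≡ less (x ⟨$⟩ʳ p) (x ⟨$⟩ʳ q)
  discordant-> {p} {q} q<p = trans (discordant-sym p q) (discordant-< q<p)

∑discordant≡len+len : (x : Perm n) → sum (λ p → sum (λ q → discordant x p q)) ≡ len x + len x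
∑discordant≡len+len x = begin
  sum (λ p → sum (λ q → inversion x p q + inversion x q p))
    ≡⟨ sum-cong-≗ (λ p → ∑-distrib-+ (inversion x p) (λ q → inversion x q p)) ⟩
  sum (λ p → sum (λ q → inversion x p q) + sum (λ q → inversion x q p))
    ≡⟨ ∑-distrib-+ (λ p → sum (inversion x p)) (λ p → sum (λ q → inversion x q p)) ⟩
  sum (λ p → sum (λ q → inversion x p q)) + sum (λ p → sum (λ q → inversion x q p))
    ≡⟨ cong (sum (λ p → sum (λ q → inversion x p q)) +_) (∑-comm (λ p q → inversion x q p)) ⟩
  sum (λ p → sum (λ q → inversion x p q)) + sum (λ q → sum (λ p → inversion x q p))
    ≡⟨ sym (cong₂ _+_ (len≡∑inversion x) (len≡∑inversion x)) ⟩
  len x + len x ∎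
  where open ≡-Reasoning

discordant-cong : {x y : Perm n} {p q : Fin n} → x ⟨$⟩ʳ p ≡ y ⟨$⟩ʳ p → x ⟨$⟩ʳ q ≡ y ⟨$⟩ʳ q →
                  discordant x p q ≡ discordant y p q
discordant-cong {p = p} {q} =
  cong₂ (λ xp xq → indicator ((p <? q) ×-dec (xq <? xp)) + indicator ((q <? p) ×-dec (xp <? xq)))

-- Each inversion is counted twice, once from each end. A position outside {i, j} is discordant with
-- at least as many of i, j after the swap, and the pair (i, j) itself becomes discordant.
module SwapAscent (x : Perm n) {i j : Fin n} (i<j : i Fin.< j) (xi<xj : x ⟨$⟩ʳ i Fin.< x ⟨$⟩ʳ j) where

  x′ : Perm n
  x′ = swapPos x i j

  discordant-mono : {k : Fin n} → k ≢ i → k ≢ j →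
    discordant x k i + discordant x k j ℕ.≤ discordant x′ k i + discordant x′ k j
  discordant-mono {k} k≢i k≢j with FinP.<-cmp k i | FinP.<-cmp k j
  ... | tri≈ _ k≡i _ | _            = contradiction k≡i k≢i
  ... | _            | tri≈ _ k≡j _ = contradiction k≡j k≢j
  ... | tri< k<i _ _ | _
    rewrite discordant-< x k<i | discordant-< x (ℕP.<-trans k<i i<j)
          | discordant-< x′ k<i | discordant-< x′ (ℕP.<-trans k<i i<j)
          | swapPos-fst x i j | swapPos-snd x i j | swapPos-other x k≢i k≢j
    = ℕP.≤-reflexive (ℕP.+-comm (less (x ⟨$⟩ʳ i) (x ⟨$⟩ʳ k)) _)
  ... | tri> _ _ i<k | tri< k<j _ _
    rewrite discordant-> x i<k | discordant-< x k<j
          | discordant-> x′ i<k | discordant-< x′ k<j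
          | swapPos-fst x i j | swapPos-snd x i j | swapPos-other x k≢i k≢j
    = ℕP.+-mono-≤ (indicator-mono (x ⟨$⟩ʳ k <? x ⟨$⟩ʳ i) (x ⟨$⟩ʳ k <? x ⟨$⟩ʳ j) (λ xk<xi → ℕP.<-trans xk<xi xi<xj))
                  (indicator-mono (x ⟨$⟩ʳ j <? x ⟨$⟩ʳ k) (x ⟨$⟩ʳ i <? x ⟨$⟩ʳ k) (ℕP.<-trans xi<xj))
  ... | tri> _ _ i<k | tri> _ _ j<k
    rewrite discordant-> x i<k | discordant-> x j<k
          | discordant-> x′ i<k | discordant-> x′ j<k
          | swapPos-fst x i j | swapPos-snd x i j | swapPos-other x k≢i k≢j
    = ℕP.≤-reflexive (ℕP.+-comm (less (x ⟨$⟩ʳ k) (x ⟨$⟩ʳ i)) _)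

  row : Perm n → Fin n → ℕ
  row y p = sum (discordant y p)

  row-mono : {k : Fin n} → k ≢ i → k ≢ j → row x k ℕ.≤ row x′ k
  row-mono k≢i k≢j = sum-mono-off₂ (<⇒≢ i<j)
    (λ q q≢i q≢j → ℕP.≤-reflexive (discordant-cong {x = x} {x′} (sym (swapPos-other x k≢i k≢j)) (sym (swapPos-other x q≢i q≢j))))
    (discordant-mono k≢i k≢j)

  pair : Perm n → Fin n → ℕ
  pair y q = discordant y i q + discordant y j q

  row-i+row-j : (y : Perm n) → row y i + row y j ≡ sum (pair y)
  row-i+row-j y = sym (∑-distrib-+ (discordant y i) (discordant y j))

  xj≮xi : ¬ x ⟨$⟩ʳ j Fin.< x ⟨$⟩ʳ i
  xj≮xi = ℕP.<-asym xi<xj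

  pair-i : pair x i ≡ 0
  pair-i rewrite discordant-refl x i | discordant-> x i<j = indicator-no (x ⟨$⟩ʳ j <? x ⟨$⟩ʳ i) xj≮xi

  pair-j : pair x j ≡ 0
  pair-j rewrite discordant-refl x j | discordant-< x i<j =
    trans (ℕP.+-identityʳ _) (indicator-no (x ⟨$⟩ʳ j <? x ⟨$⟩ʳ i) xj≮xi)

  pair-mono : ∀ q → pair x q ℕ.≤ pair x′ q
  pair-mono q = by-cases (q ≟ i) (q ≟ j)
    where
    by-cases : Dec (q ≡ i) → Dec (q ≡ j) → pair x q ℕ.≤ pair x′ q
    by-cases (yes refl) _          = ℕP.≤-trans (ℕP.≤-reflexive pair-i) z≤n
    by-cases (no _)     (yes refl) = ℕP.≤-trans (ℕP.≤-reflexive pair-j) z≤n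
    by-cases (no q≢i)   (no q≢j)
      rewrite discordant-sym x i q | discordant-sym x j q | discordant-sym x′ i q | discordant-sym x′ j q
      = discordant-mono q≢i q≢j

  pair-i-< : pair x i ℕ.< pair x′ i
  pair-i-< = begin-strict
    pair x i                ≡⟨ pair-i ⟩
    0                       <⟨ ℕP.≤-reflexive (sym (indicator-yes (x ⟨$⟩ʳ i <? x ⟨$⟩ʳ j) xi<xj)) ⟩
    less (x ⟨$⟩ʳ i) (x ⟨$⟩ʳ j) ≡⟨ sym (trans (discordant-> x′ i<j) (cong₂ less (swapPos-snd x i j) (swapPos-fst x i j))) ⟩
    discordant x′ j i      ≤⟨ ℕP.m≤n+m (discordant x′ j i) (discordant x′ i i) ⟩
    pair x′ i               ∎
    where open ℕP.≤-Reasoning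

  len-< : len x ℕ.< len x′
  len-< = ℕP.≰⇒> (λ len′≤len → ℕP.<⇒≱ twice-< (ℕP.+-mono-≤ len′≤len len′≤len))
    where
    open ℕP.≤-Reasoning
    twice-< : len x + len x ℕ.< len x′ + len x′
    twice-< = begin-strict
      len x + len x    ≡⟨ sym (∑discordant≡len+len x) ⟩
      sum (row x)      <⟨ sum-mono-<-off₂ (<⇒≢ i<j) (λ k k≢i k≢j → row-mono k≢i k≢j)
                            (begin-strict
                              row x i + row x j   ≡⟨ row-i+row-j x ⟩
                              sum (pair x)        <⟨ sum-mono-< pair-mono i pair-i-< ⟩
                              sum (pair x′)       ≡⟨ sym (row-i+row-j x′) ⟩
                              row x′ i + row x′ j ∎) ⟩
      sum (row x′)     ≡⟨ ∑discordant≡len+len x′ ⟩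
      len x′ + len x′  ∎

len-swapPos-ascent : (x : Perm n) {i j : Fin n} → i Fin.< j → x ⟨$⟩ʳ i Fin.< x ⟨$⟩ʳ j → len x ℕ.< len (swapPos x i j)
len-swapPos-ascent x i<j xi<xj = SwapAscent.len-< x i<j xi<xj

ascent-of-len-swapPos : (x : Perm n) {i j : Fin n} → i Fin.< j → len x ℕ.< len (swapPos x i j) →
                        x ⟨$⟩ʳ i Fin.< x ⟨$⟩ʳ j
ascent-of-len-swapPos {n} x {i} {j} i<j len< with FinP.<-cmp (x ⟨$⟩ʳ i) (x ⟨$⟩ʳ j)
... | tri< xi<xj _ _ = xi<xj
... | tri≈ _ xi≡xj _ = contradiction (⟨$⟩ʳ-injective x xi≡xj) (<⇒≢ i<j)
... | tri> _ _ xj<xi = contradiction len< (ℕP.<-asym (begin-strict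
  len x′                   <⟨ len-swapPos-ascent x′ i<j (subst₂ Fin._<_ (sym (swapPos-fst x i j)) (sym (swapPos-snd x i j)) xj<xi) ⟩
  len (swapPos x′ i j)     ≡⟨ len-cong {x = swapPos x′ i j} {x} (swapPos-involutive x i j) ⟩
  len x                    ∎))
  where
  open ℕP.≤-Reasoning
  x′ : Perm n
  x′ = swapPos x i j

≼-respʳ-≈ : {w x y : Perm n} → w ≼ x → x ≈ y → w ≼ y
≼-respʳ-≈ (≼-refl w≈x) x≈y = ≼-refl (λ k → trans (w≈x k) (x≈y k))
≼-respʳ-≈ (≼-step s x≼) x≈y = ≼-step s (≼-respʳ-≈ x≼ x≈y)

≼-stepʳ : {w x y : Perm n} → w ≼ x → BruhatStep x y → w ≼ y
≼-stepʳ {w = w} {x} {y} (≼-refl w≈x) (i , j , i<j , y≈ , len<) =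
  ≼-step {v = y} (i , j , i<j , (λ k → trans (y≈ k) (sym (w≈x (PC.transpose i j k))))
                             , subst (ℕ._< len y) (len-cong {x = x} {w} (λ k → sym (w≈x k))) len<)
                 (≼-refl (λ _ → refl))
≼-stepʳ (≼-step s x≼) t = ≼-step s (≼-stepʳ x≼ t)

ascent⇒BruhatStep : (x : Perm n) {i j : Fin n} → i Fin.< j → x ⟨$⟩ʳ i Fin.< x ⟨$⟩ʳ j → BruhatStep x (swapPos x i j)
ascent⇒BruhatStep x {i} {j} i<j xi<xj = i , j , i<j , (λ _ → refl) , len-swapPos-ascent x i<j xi<xj

BruhatStep⇒ascent : {x y : Perm n} → BruhatStep x y →
                    ∃[ i ] ∃[ j ] (i Fin.< j × x ⟨$⟩ʳ i Fin.< x ⟨$⟩ʳ j × y ≈ swapPos x i j)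
BruhatStep⇒ascent {x = x} {y} (i , j , i<j , y≈ , len<) =
  i , j , i<j , ascent-of-len-swapPos x i<j (subst (len x ℕ.<_) (len-cong {x = y} {swapPos x i j} y≈) len<) , y≈

≼-swapPos-ascent : {w x : Perm n} {i j : Fin n} → w ≼ x → i Fin.< j → x ⟨$⟩ʳ i Fin.< x ⟨$⟩ʳ j → w ≼ swapPos x i j
≼-swapPos-ascent {x = x} w≼x i<j xi<xj = ≼-stepʳ w≼x (ascent⇒BruhatStep x i<j xi<xj)

≺[]⇒len< : {h : Fin n → Fin n} {u v : Perm n} → u ≺[ h ] v → len u ℕ.< len v
≺[]⇒len< (≺-one  (_ , _ , _ , _ , _ , len<))      = len<
≺[]⇒len< (≺-step (_ , _ , _ , _ , _ , len<) rest) = ℕP.<-trans len< (≺[]⇒len< rest)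

-- Rank matrices

cell? : (K V p q : ℕ) → Dec (K ℕ.< p × q ℕ.≤ V)
cell? K V p q = (K ℕ.<? p) ×-dec (q ℕ.≤? V)

cell : (K V p q : ℕ) → ℕ
cell K V p q = indicator (cell? K V p q)

rank : Perm n → ℕ → ℕ → ℕ
rank x p q = sum (λ k → cell (toℕ k) (toℕ (x ⟨$⟩ʳ k)) p q)

rectangle? : (I J A B p q : ℕ) → Dec ((I ℕ.< p × p ℕ.≤ J) × (A ℕ.< q × q ℕ.≤ B))
rectangle? I J A B p q = ((I ℕ.<? p) ×-dec (p ℕ.≤? J)) ×-dec ((A ℕ.<? q) ×-dec (q ℕ.≤? B))

rectangle : (I J A B p q : ℕ) → ℕ
rectangle I J A B p q = indicator (rectangle? I J A B p q)

cell-exchange : {I J A B : ℕ} → I ℕ.< J → A ℕ.< B → ∀ p q →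
                cell I B p q + cell J A p q ≡ (cell I A p q + cell J B p q) + rectangle I J A B p q
cell-exchange {I} {J} {A} {B} I<J A<B p q = begin
  cell I B p q + cell J A p q                           ≡⟨ cong₂ _+_ (trans (factor I B) (cong₂ _*_ split-position split-value))
                                                                    (factor J A) ⟩
  (β + s) * (γ + t) + β * γ                             ≡⟨ solve 4 (λ β s γ t → (β :+ s) :* (γ :+ t) :+ β :* γ
                                                                  := ((β :+ s) :* γ :+ β :* (γ :+ t)) :+ s :* t) refl β s γ t ⟩
  ((β + s) * γ + β * (γ + t)) + s * t                   ≡⟨ cong₂ _+_ (cong₂ _+_ (trans (factor I A) (cong (_* γ) split-position))
                                                                               (trans (factor J B) (cong (β *_) split-value)))
                                                                    (indicator-× ((I ℕ.<? p) ×-dec (p ℕ.≤? J)) ((A ℕ.<? q) ×-dec (q ℕ.≤? B))) ⟨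
  (cell I A p q + cell J B p q) + rectangle I J A B p q ∎
  where
  open ≡-Reasoning
  open +-*-Solver
  factor : ∀ K V → cell K V p q ≡ indicator (K ℕ.<? p) * indicator (q ℕ.≤? V)
  factor K V = indicator-× (K ℕ.<? p) (q ℕ.≤? V)
  β s γ t : ℕ
  β = indicator (J ℕ.<? p)
  s = indicator ((I ℕ.<? p) ×-dec (p ℕ.≤? J))
  γ = indicator (q ℕ.≤? A)
  t = indicator ((A ℕ.<? q) ×-dec (q ℕ.≤? B))
  split-position : indicator (I ℕ.<? p) ≡ β + s
  split-position = indicator-split (I ℕ.<? p) (J ℕ.<? p) ((I ℕ.<? p) ×-dec (p ℕ.≤? J))
    (ℕP.<-trans I<J) (λ I<p J≮p → I<p , ℕP.≮⇒≥ J≮p) (λ (I<p , p≤J) → I<p , ℕP.≤⇒≯ p≤J)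
  split-value : indicator (q ℕ.≤? B) ≡ γ + t
  split-value = indicator-split (q ℕ.≤? B) (q ℕ.≤? A) ((A ℕ.<? q) ×-dec (q ℕ.≤? B))
    (λ q≤A → ℕP.≤-trans q≤A (ℕP.<⇒≤ A<B)) (λ q≤B q≰A → ℕP.≰⇒> q≰A , q≤B) (λ (A<q , q≤B) → q≤B , ℕP.<⇒≱ A<q)

rank-agree : {x y : Perm n} {p : ℕ} → (∀ k → toℕ k ℕ.< p → x ⟨$⟩ʳ k ≡ y ⟨$⟩ʳ k) → ∀ q → rank x p q ≡ rank y p q
rank-agree {x = x} {y} {p} agree q = sum-cong-≗ same-cell
  where
  same-cell : ∀ k → cell (toℕ k) (toℕ (x ⟨$⟩ʳ k)) p q ≡ cell (toℕ k) (toℕ (y ⟨$⟩ʳ k)) p q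
  same-cell k with toℕ k ℕ.<? p
  ... | yes k<p = cong (λ v → cell (toℕ k) (toℕ v) p q) (agree k k<p)
  ... | no k≮p rewrite dec-false (toℕ k ℕ.<? p) k≮p = refl

rank-cong : {x y : Perm n} → x ≈ y → ∀ p q → rank x p q ≡ rank y p q
rank-cong {x = x} {y} x≈y p = rank-agree {x = x} {y} {p} (λ k _ → x≈y k)

rank-swapPos : (x : Perm n) {i j : Fin n} → i Fin.< j → x ⟨$⟩ʳ i Fin.< x ⟨$⟩ʳ j → ∀ p q →
               rank (swapPos x i j) p q ≡ rank x p q + rectangle (toℕ i) (toℕ j) (toℕ (x ⟨$⟩ʳ i)) (toℕ (x ⟨$⟩ʳ j)) p q
rank-swapPos {n} x {i} {j} i<j xi<xj p q = ℕP.+-cancelʳ-≡ (f i + f j) _ _ (begin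
  rank x′ p q + (f i + f j)                   ≡⟨ sum-agree-off₂ (<⇒≢ i<j) agree-off ⟩
  rank x p q + (f′ i + f′ j)                  ≡⟨ cong (rank x p q +_) exchange ⟩
  rank x p q + ((f i + f j) + R)              ≡⟨ solve 3 (λ r s t → r :+ (s :+ t) := (r :+ t) :+ s) refl (rank x p q) (f i + f j) R ⟩
  (rank x p q + R) + (f i + f j)              ∎)
  where
  open ≡-Reasoning
  open +-*-Solver
  x′ : Perm n
  x′ = swapPos x i j
  f f′ : Fin n → ℕ
  f k = cell (toℕ k) (toℕ (x ⟨$⟩ʳ k)) p q
  f′ k = cell (toℕ k) (toℕ (x′ ⟨$⟩ʳ k)) p q
  R : ℕ
  R = rectangle (toℕ i) (toℕ j) (toℕ (x ⟨$⟩ʳ i)) (toℕ (x ⟨$⟩ʳ j)) p q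
  agree-off : ∀ k → k ≢ i → k ≢ j → f k ≡ f′ k
  agree-off k k≢i k≢j = cong (λ v → cell (toℕ k) (toℕ v) p q) (sym (swapPos-other x k≢i k≢j))
  exchange : f′ i + f′ j ≡ (f i + f j) + R
  exchange rewrite swapPos-fst x i j | swapPos-snd x i j = cell-exchange i<j xi<xj p q

inWindow? : (x : Perm n) (lo p q : ℕ) (k : Fin n) → Dec (lo ℕ.≤ toℕ k × toℕ k ℕ.< p × q ℕ.≤ toℕ (x ⟨$⟩ʳ k))
inWindow? x lo p q k = (lo ℕ.≤? toℕ k) ×-dec cell? (toℕ k) (toℕ (x ⟨$⟩ʳ k)) p q

window : Perm n → (lo p q : ℕ) → ℕ
window x lo p q = sum (indicator ∘ inWindow? x lo p q)

rank-split : (x : Perm n) {lo p : ℕ} → lo ℕ.≤ p → ∀ q → rank x p q ≡ rank x lo q + window x lo p q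
rank-split x {lo} {p} lo≤p q =
  trans (sum-cong-≗ split) (∑-distrib-+ (λ k → cell (toℕ k) (toℕ (x ⟨$⟩ʳ k)) lo q) (indicator ∘ inWindow? x lo p q))
  where
  split : ∀ k → cell (toℕ k) (toℕ (x ⟨$⟩ʳ k)) p q ≡ cell (toℕ k) (toℕ (x ⟨$⟩ʳ k)) lo q + indicator (inWindow? x lo p q k)
  split k = indicator-split (cell? (toℕ k) (toℕ (x ⟨$⟩ʳ k)) p q) (cell? (toℕ k) (toℕ (x ⟨$⟩ʳ k)) lo q) (inWindow? x lo p q k)
    (λ (k<lo , q≤) → ℕP.<-≤-trans k<lo lo≤p , q≤)
    (λ (k<p , q≤) ¬below → ℕP.≮⇒≥ (λ k<lo → ¬below (k<lo , q≤)) , k<p , q≤)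
    (λ (lo≤k , k<p , q≤) → (k<p , q≤) , λ (k<lo , _) → ℕP.<⇒≱ k<lo lo≤k)

window-single : (x : Perm n) (i : Fin n) → ∀ q → window x (toℕ i) (suc (toℕ i)) q ≡ indicator (q ℕ.≤? toℕ (x ⟨$⟩ʳ i))
window-single x i q = trans (sum-concentrated (indicator ∘ inWindow? x I (suc I) q) i outside) at-i
  where
  I : ℕ
  I = toℕ i
  outside : ∀ k → k ≢ i → indicator (inWindow? x I (suc I) q k) ≡ 0
  outside k k≢i = indicator-no (inWindow? x I (suc I) q k)
    (λ (i≤k , k<1+i , _) → k≢i (FinP.toℕ-injective (ℕP.≤-antisym (ℕP.≤-pred k<1+i) i≤k)))
  at-i : indicator (inWindow? x I (suc I) q i) ≡ indicator (q ℕ.≤? toℕ (x ⟨$⟩ʳ i))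
  at-i rewrite dec-true (I ℕ.≤? I) ℕP.≤-refl | dec-true (I ℕ.<? suc I) ℕP.≤-refl = refl

rank-suc : (x : Perm n) (i : Fin n) → ∀ q → rank x (suc (toℕ i)) q ≡ rank x (toℕ i) q + indicator (q ℕ.≤? toℕ (x ⟨$⟩ʳ i))
rank-suc x i q = trans (rank-split x (ℕP.n≤1+n (toℕ i)) q) (cong (rank x (toℕ i) q +_) (window-single x i q))

window-strictly-antitone : (x : Perm n) {lo p q q′ : ℕ} (k : Fin n) → lo ℕ.≤ toℕ k → toℕ k ℕ.< p →
                           q ℕ.≤ toℕ (x ⟨$⟩ʳ k) → toℕ (x ⟨$⟩ʳ k) ℕ.< q′ → window x lo p q′ ℕ.< window x lo p q
window-strictly-antitone x {lo} {p} {q} {q′} k lo≤k k<p q≤xk xk<q′ = sum-mono-< antitone k (begin-strict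
  indicator (inWindow? x lo p q′ k) ≡⟨ indicator-no (inWindow? x lo p q′ k) (λ (_ , _ , q′≤xk) → ℕP.<⇒≱ xk<q′ q′≤xk) ⟩
  0                                 <⟨ ℕP.0<1+n ⟩
  1                                 ≡⟨ indicator-yes (inWindow? x lo p q k) (lo≤k , k<p , q≤xk) ⟨
  indicator (inWindow? x lo p q k)  ∎)
  where
  open ℕP.≤-Reasoning
  antitone : ∀ l → indicator (inWindow? x lo p q′ l) ℕ.≤ indicator (inWindow? x lo p q l)
  antitone l = indicator-mono (inWindow? x lo p q′ l) (inWindow? x lo p q l)
    (λ (lo≤l , l<p , q′≤) → lo≤l , l<p , ℕP.≤-trans (ℕP.≤-trans q≤xk (ℕP.<⇒≤ xk<q′)) q′≤)

-- The rank criterion for the Bruhat order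

infix 4 _⊑_
_⊑_ : Perm n → Perm n → Set
x ⊑ y = ∀ p q → rank x p q ℕ.≤ rank y p q

⊑-swapPos-ascent : (x : Perm n) {i j : Fin n} → i Fin.< j → x ⟨$⟩ʳ i Fin.< x ⟨$⟩ʳ j → x ⊑ swapPos x i j
⊑-swapPos-ascent x i<j xi<xj p q = ℕP.≤-trans (ℕP.m≤m+n (rank x p q) _) (ℕP.≤-reflexive (sym (rank-swapPos x i<j xi<xj p q)))

≼⇒⊑ : {x y : Perm n} → x ≼ y → x ⊑ y
≼⇒⊑ {x = x} {y} (≼-refl x≈y) p q = ℕP.≤-reflexive (rank-cong {x = x} {y} x≈y p q)
≼⇒⊑ {x = x} {y} (≼-step {v = v} step v≼y) p q with BruhatStep⇒ascent {x = x} {v} step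
... | i , j , i<j , xi<xj , v≈ = begin
  rank x p q               ≤⟨ ⊑-swapPos-ascent x i<j xi<xj p q ⟩
  rank (swapPos x i j) p q ≡⟨ rank-cong {x = swapPos x i j} {v} (λ k → sym (v≈ k)) p q ⟩
  rank v p q               ≤⟨ ≼⇒⊑ v≼y p q ⟩
  rank y p q               ∎
  where open ℕP.≤-Reasoning

least : {P : Fin n → Set} → Decidable P → ∃ P → ∃[ i ] (P i × (∀ k → k Fin.< i → ¬ P k))
least {n} {P} P? (i₀ , Pi₀) with FinP.¬∀⟶∃¬-smallest n (¬_ ∘ P) (¬? ∘ P?) (λ none → none i₀ Pi₀)
... | i , ¬¬Pi , below = i , decidable-stable (P? i) ¬¬Pi , λ k k<i → subst (¬_ ∘ P) (as-inject k k<i) (below (Fin.fromℕ< k<i))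
  where
  as-inject : ∀ k (k<i : k Fin.< i) → Fin.inject {i = i} (Fin.fromℕ< k<i) ≡ k
  as-inject k k<i = FinP.toℕ-injective (trans (FinP.toℕ-inject (Fin.fromℕ< k<i)) (FinP.toℕ-fromℕ< k<i))

gap : Perm n → Perm n → ℕ
gap {n} y x = sum (λ (p : Fin (suc n)) → sum (λ (q : Fin n) → rank y (toℕ p) (toℕ q) ∸ rank x (toℕ p) (toℕ q)))

-- For x ⊑ y with x ≠ y: at the first position i where they differ x(i) < y(i), and swapping i with the
-- first j > i having x(i) < x(j) ≤ y(i) gives a Bruhat cover x′ of x that is still ⊑ y and closer to y.
module Ascend {x y : Perm n} (x⊑y : x ⊑ y) (x≉y : ¬ x ≈ y) where

  private
    first-difference : ∃[ i ] (x ⟨$⟩ʳ i ≢ y ⟨$⟩ʳ i × (∀ k → k Fin.< i → ¬ x ⟨$⟩ʳ k ≢ y ⟨$⟩ʳ k))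
    first-difference = least (λ k → ¬? (x ⟨$⟩ʳ k ≟ y ⟨$⟩ʳ k)) (FinP.¬∀⟶∃¬ n _ (λ k → x ⟨$⟩ʳ k ≟ y ⟨$⟩ʳ k) x≉y)

  i : Fin n
  i = proj₁ first-difference

  I A Y : ℕ
  I = toℕ i
  A = toℕ (x ⟨$⟩ʳ i)
  Y = toℕ (y ⟨$⟩ʳ i)

  agree-before-i : ∀ k → k Fin.< i → x ⟨$⟩ʳ k ≡ y ⟨$⟩ʳ k
  agree-before-i k k<i = decidable-stable (x ⟨$⟩ʳ k ≟ y ⟨$⟩ʳ k) (proj₂ (proj₂ first-difference) k k<i)

  rank-before-i : ∀ q → rank x I q ≡ rank y I q
  rank-before-i = rank-agree {x = x} {y} agree-before-i

  xi<yi : x ⟨$⟩ʳ i Fin.< y ⟨$⟩ʳ i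
  xi<yi with FinP.<-cmp (x ⟨$⟩ʳ i) (y ⟨$⟩ʳ i)
  ... | tri< xi<yi _ _ = xi<yi
  ... | tri≈ _ xi≡yi _ = contradiction xi≡yi (proj₁ (proj₂ first-difference))
  ... | tri> _ _ yi<xi = contradiction (ℕP.+-cancelˡ-≤ (rank y I A) 1 0 (begin
    rank y I A + 1                     ≡⟨ cong₂ _+_ (rank-before-i A) (indicator-yes (A ℕ.≤? A) ℕP.≤-refl) ⟨
    rank x I A + indicator (A ℕ.≤? A)  ≡⟨ rank-suc x i A ⟨
    rank x (suc I) A                   ≤⟨ x⊑y (suc I) A ⟩
    rank y (suc I) A                   ≡⟨ rank-suc y i A ⟩
    rank y I A + indicator (A ℕ.≤? Y)  ≡⟨ cong (rank y I A +_) (indicator-no (A ℕ.≤? Y) (ℕP.<⇒≱ yi<xi)) ⟩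
    rank y I A + 0                     ∎)) λ ()
    where open ℕP.≤-Reasoning

  Partner : Fin n → Set
  Partner k = i Fin.< k × x ⟨$⟩ʳ i Fin.< x ⟨$⟩ʳ k × x ⟨$⟩ʳ k Fin.≤ y ⟨$⟩ʳ i

  private
    partner-of-yi : Partner (x ⟨$⟩ˡ (y ⟨$⟩ʳ i))
    partner-of-yi with FinP.<-cmp (x ⟨$⟩ˡ (y ⟨$⟩ʳ i)) i
    ... | tri< k₀<i _ _ = contradiction (⟨$⟩ʳ-injective y (trans (sym (agree-before-i _ k₀<i)) (inverseʳ x))) (<⇒≢ k₀<i)
    ... | tri≈ _ k₀≡i _ = contradiction (trans (cong (x ⟨$⟩ʳ_) (sym k₀≡i)) (inverseʳ x)) (proj₁ (proj₂ first-difference))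
    ... | tri> _ _ i<k₀ = i<k₀ , subst (x ⟨$⟩ʳ i Fin.<_) (sym (inverseʳ x)) xi<yi , ℕP.≤-reflexive (cong toℕ (inverseʳ x))

    first-partner : ∃[ j ] (Partner j × (∀ k → k Fin.< j → ¬ Partner k))
    first-partner = least (λ k → (i Fin.<? k) ×-dec ((x ⟨$⟩ʳ i Fin.<? x ⟨$⟩ʳ k) ×-dec (x ⟨$⟩ʳ k Fin.≤? y ⟨$⟩ʳ i)))
                          (_ , partner-of-yi)

  j : Fin n
  j = proj₁ first-partner

  J B : ℕ
  J = toℕ j
  B = toℕ (x ⟨$⟩ʳ j)

  i<j : i Fin.< j
  i<j = proj₁ (proj₁ (proj₂ first-partner))

  xi<xj : x ⟨$⟩ʳ i Fin.< x ⟨$⟩ʳ j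
  xi<xj = proj₁ (proj₂ (proj₁ (proj₂ first-partner)))

  xj≤yi : x ⟨$⟩ʳ j Fin.≤ y ⟨$⟩ʳ i
  xj≤yi = proj₂ (proj₂ (proj₁ (proj₂ first-partner)))

  x′ : Perm n
  x′ = swapPos x i j

  step : BruhatStep x x′
  step = ascent⇒BruhatStep x i<j xi<xj

  -- Minimality of j: between i and j, no value of x lies in (x(i), y(i)].
  window-skips-to-yi : ∀ {p q} → p ℕ.≤ J → A ℕ.< q → q ℕ.≤ B → window x I p q ≡ window x I p (suc Y)
  window-skips-to-yi {p} {q} p≤J A<q q≤B = sum-cong-≗ (λ k →
    indicator-cong (inWindow? x I p q k) (inWindow? x I p (suc Y) k)
      (λ (I≤k , k<p , q≤xk) → I≤k , k<p , above-yi k I≤k (ℕP.<-≤-trans k<p p≤J) (ℕP.<-≤-trans A<q q≤xk))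
      (λ (I≤k , k<p , Y<xk) → I≤k , k<p , ℕP.≤-trans (ℕP.≤-trans q≤B xj≤yi) (ℕP.<⇒≤ Y<xk)))
    where
    above-yi : ∀ k → I ℕ.≤ toℕ k → k Fin.< j → x ⟨$⟩ʳ i Fin.< x ⟨$⟩ʳ k → y ⟨$⟩ʳ i Fin.< x ⟨$⟩ʳ k
    above-yi k I≤k k<j xi<xk with i ≟ k
    ... | yes refl = contradiction xi<xk (ℕP.<-irrefl refl)
    ... | no i≢k   = ℕP.≰⇒> (λ xk≤yi →
      proj₂ (proj₂ first-partner) k k<j (ℕP.≤∧≢⇒< I≤k (i≢k ∘ FinP.toℕ-injective) , xi<xk , xk≤yi))

  rank-<-in-rectangle : ∀ {p q} → I ℕ.< p → p ℕ.≤ J → A ℕ.< q → q ℕ.≤ B → rank x p q ℕ.< rank y p q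
  rank-<-in-rectangle {p} {q} I<p p≤J A<q q≤B = begin-strict
    rank x p q                     ≡⟨ rank-split x (ℕP.<⇒≤ I<p) q ⟩
    rank x I q + window x I p q    ≡⟨ cong₂ _+_ (rank-before-i q) (window-skips-to-yi p≤J A<q q≤B) ⟩
    rank y I q + window x I p (suc Y) ≤⟨ ℕP.+-monoʳ-≤ (rank y I q) window-≤ ⟩
    rank y I q + window y I p (suc Y) <⟨ ℕP.+-monoʳ-< (rank y I q)
                                          (window-strictly-antitone y i ℕP.≤-refl I<p (ℕP.≤-trans q≤B xj≤yi) ℕP.≤-refl) ⟩
    rank y I q + window y I p q    ≡⟨ rank-split y (ℕP.<⇒≤ I<p) q ⟨
    rank y p q                     ∎
    where
    open ℕP.≤-Reasoning
    window-≤ : window x I p (suc Y) ℕ.≤ window y I p (suc Y)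
    window-≤ = ℕP.+-cancelˡ-≤ (rank y I (suc Y)) _ _ (begin
      rank y I (suc Y) + window x I p (suc Y) ≡⟨ cong (_+ window x I p (suc Y)) (rank-before-i (suc Y)) ⟨
      rank x I (suc Y) + window x I p (suc Y) ≡⟨ rank-split x (ℕP.<⇒≤ I<p) (suc Y) ⟨
      rank x p (suc Y)                        ≤⟨ x⊑y p (suc Y) ⟩
      rank y p (suc Y)                        ≡⟨ rank-split y (ℕP.<⇒≤ I<p) (suc Y) ⟩
      rank y I (suc Y) + window y I p (suc Y) ∎)

  x′⊑y : x′ ⊑ y
  x′⊑y p q = begin
    rank x′ p q                        ≡⟨ rank-swapPos x i<j xi<xj p q ⟩
    rank x p q + rectangle I J A B p q ≤⟨ by-cases (rectangle? I J A B p q) ⟩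
    rank y p q                         ∎
    where
    open ℕP.≤-Reasoning
    by-cases : Dec ((I ℕ.< p × p ℕ.≤ J) × (A ℕ.< q × q ℕ.≤ B)) → rank x p q + rectangle I J A B p q ℕ.≤ rank y p q
    by-cases (yes inside@((I<p , p≤J) , (A<q , q≤B))) = begin
      rank x p q + rectangle I J A B p q ≡⟨ cong (rank x p q +_) (indicator-yes (rectangle? I J A B p q) inside) ⟩
      rank x p q + 1                     ≡⟨ ℕP.+-comm (rank x p q) 1 ⟩
      suc (rank x p q)                   ≤⟨ rank-<-in-rectangle I<p p≤J A<q q≤B ⟩
      rank y p q                         ∎
    by-cases (no outside) = begin
      rank x p q + rectangle I J A B p q ≡⟨ cong (rank x p q +_) (indicator-no (rectangle? I J A B p q) outside) ⟩
      rank x p q + 0                     ≡⟨ ℕP.+-identityʳ (rank x p q) ⟩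
      rank x p q                         ≤⟨ x⊑y p q ⟩
      rank y p q                         ∎

  gap-decreases : gap y x′ ℕ.< gap y x
  gap-decreases = sum-mono-< (λ p → sum-mono (λ q → shrinks p q)) (Fin.suc i)
                    (sum-mono-< (shrinks (Fin.suc i)) (x ⟨$⟩ʳ j) (ℕP.∸-monoʳ-< x<x′ (x′⊑y (suc I) B)))
    where
    shrinks : ∀ (p : Fin (suc n)) (q : Fin n) →
              rank y (toℕ p) (toℕ q) ∸ rank x′ (toℕ p) (toℕ q) ℕ.≤ rank y (toℕ p) (toℕ q) ∸ rank x (toℕ p) (toℕ q)
    shrinks p q = ℕP.∸-monoʳ-≤ (rank y (toℕ p) (toℕ q)) (⊑-swapPos-ascent x i<j xi<xj (toℕ p) (toℕ q))
    x<x′ : rank x (suc I) B ℕ.< rank x′ (suc I) B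
    x<x′ = begin-strict
      rank x (suc I) B                              <⟨ ℕP.n<1+n _ ⟩
      suc (rank x (suc I) B)                        ≡⟨ ℕP.+-comm 1 (rank x (suc I) B) ⟩
      rank x (suc I) B + 1                          ≡⟨ cong (rank x (suc I) B +_) (indicator-yes (rectangle? I J A B (suc I) B)
                                                          ((ℕP.≤-refl , i<j) , (xi<xj , ℕP.≤-refl))) ⟨
      rank x (suc I) B + rectangle I J A B (suc I) B ≡⟨ rank-swapPos x i<j xi<xj (suc I) B ⟨
      rank x′ (suc I) B                             ∎
      where open ℕP.≤-Reasoning

⊑⇒≼ : {x y : Perm n} → x ⊑ y → x ≼ y
⊑⇒≼ {x = x} {y} = ascend x (<-wellFounded (gap y x))
  where
  ascend : ∀ x → Acc ℕ._<_ (gap y x) → x ⊑ y → x ≼ y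
  ascend x (acc smaller) x⊑y with FinP.all? (λ k → x ⟨$⟩ʳ k ≟ y ⟨$⟩ʳ k)
  ... | yes x≈y = ≼-refl x≈y
  ... | no x≉y  = ≼-step step (ascend x′ (smaller gap-decreases) x′⊑y)
    where open Ascend {x = x} {y} x⊑y x≉y using (x′; step; x′⊑y; gap-decreases)

⊑-stable : {x y : Perm n} → ¬ ¬ x ⊑ y → x ⊑ y
⊑-stable {x = x} {y} ¬¬x⊑y p q = decidable-stable (rank x p q ℕ.≤? rank y p q) (λ ≰ → ¬¬x⊑y (λ x⊑y → ≰ (x⊑y p q)))

≼-stable : {x y : Perm n} → ¬ ¬ x ≼ y → x ≼ y
≼-stable {x = x} {y} ¬¬x≼y = ⊑⇒≼ (⊑-stable {x = x} {y} (λ ⋢ → ¬¬x≼y (⋢ ∘ ≼⇒⊑)))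

-- The rectangles added by the two swaps are disjoint, so at every entry one of them leaves the rank of z unchanged.
≼-unswap : {w z : Perm n} {p₁ p₂ p₃ : Fin n} → p₁ Fin.< p₂ → p₂ Fin.< p₃ →
           z ⟨$⟩ʳ p₁ Fin.< z ⟨$⟩ʳ p₂ → z ⟨$⟩ʳ p₂ Fin.< z ⟨$⟩ʳ p₃ →
           w ≼ swapPos z p₁ p₂ → w ≼ swapPos z p₂ p₃ → w ≼ z
≼-unswap {w = w} {z} {p₁} {p₂} {p₃} p₁<p₂ p₂<p₃ z₁<z₂ z₂<z₃ w≼z₁₂ w≼z₂₃ = ⊑⇒≼ w⊑z
  where
  unchanged : ∀ {i j} (i<j : i Fin.< j) (zi<zj : z ⟨$⟩ʳ i Fin.< z ⟨$⟩ʳ j) p q →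
              ¬ ((toℕ i ℕ.< p × p ℕ.≤ toℕ j) × (toℕ (z ⟨$⟩ʳ i) ℕ.< q × q ℕ.≤ toℕ (z ⟨$⟩ʳ j))) →
              rank (swapPos z i j) p q ≡ rank z p q
  unchanged {i} {j} i<j zi<zj p q outside = begin
    rank (swapPos z i j) p q  ≡⟨ rank-swapPos z i<j zi<zj p q ⟩
    rank z p q + rectangle (toℕ i) (toℕ j) (toℕ (z ⟨$⟩ʳ i)) (toℕ (z ⟨$⟩ʳ j)) p q
      ≡⟨ cong (rank z p q +_) (indicator-no (rectangle? (toℕ i) (toℕ j) (toℕ (z ⟨$⟩ʳ i)) (toℕ (z ⟨$⟩ʳ j)) p q) outside) ⟩
    rank z p q + 0             ≡⟨ ℕP.+-identityʳ (rank z p q) ⟩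
    rank z p q                 ∎
    where open ≡-Reasoning
  w⊑z : w ⊑ z
  w⊑z p q with rectangle? (toℕ p₁) (toℕ p₂) (toℕ (z ⟨$⟩ʳ p₁)) (toℕ (z ⟨$⟩ʳ p₂)) p q
  ... | yes ((_ , p≤p₂) , _) = ℕP.≤-trans (≼⇒⊑ w≼z₂₃ p q)
        (ℕP.≤-reflexive (unchanged p₂<p₃ z₂<z₃ p q (λ ((p₂<p , _) , _) → ℕP.<⇒≱ p₂<p p≤p₂)))
  ... | no outside = ℕP.≤-trans (≼⇒⊑ w≼z₁₂ p q) (ℕP.≤-reflexive (unchanged p₁<p₂ z₁<z₂ p q outside))

-- Lower bounds by w are transported from swaps of u to swaps of v = u(a,b).
module Exchange {w u : Perm n} {a b : Fin n} (w≼u : w ≼ u) (a<b : a Fin.< b) (ua<ub : u ⟨$⟩ʳ a Fin.< u ⟨$⟩ʳ b) where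

  v : Perm n
  v = swapPos u a b

  private
    w≼v : w ≼ v
    w≼v = ≼-swapPos-ascent w≼u a<b ua<ub

    a≢b : a ≢ b
    a≢b = <⇒≢ a<b

  ≼-fixed-ab : w ≼ swapPos v a b
  ≼-fixed-ab = ≼-respʳ-≈ w≼u (λ k → sym (swapPos-involutive u a b k))

  ≼-fixed-order-preserved : ∀ {i j} → w ≼ swapPos u i j → PC.transpose i j a Fin.< PC.transpose i j b →
                            w ≼ swapPos v i j
  ≼-fixed-order-preserved {i} {j} w≼uij σa<σb =
    ≼-respʳ-≈ (≼-swapPos-ascent w≼uij σa<σb ascent) (λ k → sym (swapPos-conjugate′ u refl refl k))
    where
    ascent : swapPos u i j ⟨$⟩ʳ PC.transpose i j a Fin.< swapPos u i j ⟨$⟩ʳ PC.transpose i j b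
    ascent = subst₂ Fin._<_ (cong (u ⟨$⟩ʳ_) (sym (transpose-involutive i j a)))
                            (cong (u ⟨$⟩ʳ_) (sym (transpose-involutive i j b))) ua<ub

  ≼-moved-right : ∀ {j} → b Fin.< j → w ≼ swapPos u a j → w ≼ swapPos v b j
  ≼-moved-right {j} b<j w≼uaj = by-cases (FinP.<-cmp (u ⟨$⟩ʳ a) (u ⟨$⟩ʳ j))
    where
    j≢a : j ≢ a
    j≢a = <⇒≢ (ℕP.<-trans a<b b<j) ∘ sym
    j≢b : j ≢ b
    j≢b = <⇒≢ b<j ∘ sym
    b≢a : b ≢ a
    b≢a = a≢b ∘ sym
    b≢j : b ≢ j
    b≢j = <⇒≢ b<j
    by-cases : Tri (u ⟨$⟩ʳ a Fin.< u ⟨$⟩ʳ j) (u ⟨$⟩ʳ a ≡ u ⟨$⟩ʳ j) (u ⟨$⟩ʳ j Fin.< u ⟨$⟩ʳ a) → w ≼ swapPos v b j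
    by-cases (tri< ua<uj _ _) =
      ≼-swapPos-ascent w≼v b<j (subst₂ Fin._<_ (sym (swapPos-snd u a b)) (sym (swapPos-other u j≢a j≢b)) ua<uj)
    by-cases (tri≈ _ ua≡uj _) = contradiction (⟨$⟩ʳ-injective u ua≡uj) (j≢a ∘ sym)
    by-cases (tri> _ _ uj<ua) =
      ≼-respʳ-≈ (≼-swapPos-ascent w≼uaj a<b (subst₂ Fin._<_ (sym (swapPos-fst u a j)) (sym (swapPos-other u b≢a b≢j))
                                                          (ℕP.<-trans uj<ua ua<ub)))
                (λ k → sym (swapPos-conjugate u (transpose-snd a b) (transpose-other j≢a j≢b) k))

  ≼-moved-left : ∀ {i} → i Fin.< a → w ≼ swapPos u i b → w ≼ swapPos v i a
  ≼-moved-left {i} i<a w≼uib = by-cases (FinP.<-cmp (u ⟨$⟩ʳ i) (u ⟨$⟩ʳ b))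
    where
    i≢a : i ≢ a
    i≢a = <⇒≢ i<a
    i≢b : i ≢ b
    i≢b = <⇒≢ (ℕP.<-trans i<a a<b)
    a≢i : a ≢ i
    a≢i = i≢a ∘ sym
    by-cases : Tri (u ⟨$⟩ʳ i Fin.< u ⟨$⟩ʳ b) (u ⟨$⟩ʳ i ≡ u ⟨$⟩ʳ b) (u ⟨$⟩ʳ b Fin.< u ⟨$⟩ʳ i) → w ≼ swapPos v i a
    by-cases (tri< ui<ub _ _) =
      ≼-swapPos-ascent w≼v i<a (subst₂ Fin._<_ (sym (swapPos-other u i≢a i≢b)) (sym (swapPos-fst u a b)) ui<ub)
    by-cases (tri≈ _ ui≡ub _) = contradiction (⟨$⟩ʳ-injective u ui≡ub) i≢b
    by-cases (tri> _ _ ub<ui) =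
      ≼-respʳ-≈ (≼-swapPos-ascent w≼uib a<b (subst₂ Fin._<_ (sym (swapPos-other u a≢i a≢b)) (sym (swapPos-snd u i b))
                                                          (ℕP.<-trans ua<ub ub<ui)))
                (λ k → sym (swapPos-conjugate u (transpose-other i≢a i≢b) (transpose-fst a b) k))

  ≼-fixed-right : ∀ {j} → b Fin.< j → w ≼ swapPos u a j → w ≼ swapPos u b j → w ≼ swapPos v a j
  ≼-fixed-right {j} b<j w≼uaj w≼ubj = by-cases (FinP.<-cmp (u ⟨$⟩ʳ a) (u ⟨$⟩ʳ j))
    where
    j≢a : j ≢ a
    j≢a = <⇒≢ (ℕP.<-trans a<b b<j) ∘ sym
    j≢b : j ≢ b
    j≢b = <⇒≢ b<j ∘ sym
    b≢a : b ≢ a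
    b≢a = a≢b ∘ sym
    b≢j : b ≢ j
    b≢j = <⇒≢ b<j
    a≢j : a ≢ j
    a≢j = j≢a ∘ sym
    z : Perm n
    z = swapPos v a j
    z≈ubj-ab : z ≈ swapPos (swapPos u b j) a b
    z≈ubj-ab = swapPos-conjugate u (transpose-fst a b) (transpose-other j≢a j≢b)
    by-cases : Tri (u ⟨$⟩ʳ a Fin.< u ⟨$⟩ʳ j) (u ⟨$⟩ʳ a ≡ u ⟨$⟩ʳ j) (u ⟨$⟩ʳ j Fin.< u ⟨$⟩ʳ a) → w ≼ z
    by-cases (tri< ua<uj _ _) =
      ≼-respʳ-≈ (≼-swapPos-ascent w≼ubj a<b (subst₂ Fin._<_ (sym (swapPos-other u a≢b a≢j)) (sym (swapPos-fst u b j)) ua<uj))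
                (λ k → sym (z≈ubj-ab k))
    by-cases (tri≈ _ ua≡uj _) = contradiction (⟨$⟩ʳ-injective u ua≡uj) a≢j
    by-cases (tri> _ _ uj<ua) = ≼-unswap a<b b<j
      (subst₂ Fin._<_ (sym z-a) (sym z-b) uj<ua) (subst₂ Fin._<_ (sym z-b) (sym z-j) ua<ub)
      (≼-respʳ-≈ w≼ubj (λ k → sym (z-ab k))) (≼-respʳ-≈ w≼uaj (λ k → sym (z-bj k)))
      where
      open ≈-Reasoning
      z-a : z ⟨$⟩ʳ a ≡ u ⟨$⟩ʳ j
      z-a = trans (swapPos-fst v a j) (swapPos-other u j≢a j≢b)
      z-b : z ⟨$⟩ʳ b ≡ u ⟨$⟩ʳ a
      z-b = trans (swapPos-other v b≢a b≢j) (swapPos-snd u a b)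
      z-j : z ⟨$⟩ʳ j ≡ u ⟨$⟩ʳ b
      z-j = trans (swapPos-snd v a j) (swapPos-fst u a b)
      z-ab : swapPos z a b ≈ swapPos u b j
      z-ab = begin
        swapPos z a b                           ≈⟨ swapPos-cong {x = z} {swapPos (swapPos u b j) a b} z≈ubj-ab a b ⟩
        swapPos (swapPos (swapPos u b j) a b) a b ≈⟨ swapPos-involutive (swapPos u b j) a b ⟩
        swapPos u b j                           ∎
      z-bj : swapPos z b j ≈ swapPos u a j
      z-bj = begin
        swapPos z b j                             ≈⟨ swapPos-cong {x = z} {swapPos (swapPos u a j) j b}
                                                       (swapPos-conjugate′ u (transpose-fst a j) (transpose-other b≢a b≢j)) b j ⟩
        swapPos (swapPos (swapPos u a j) j b) b j ≈⟨ swapPos-cong {x = swapPos (swapPos u a j) j b} {swapPos (swapPos u a j) b j}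
                                                       (swapPos-sym (swapPos u a j) j b) b j ⟩
        swapPos (swapPos (swapPos u a j) b j) b j ≈⟨ swapPos-involutive (swapPos u a j) b j ⟩
        swapPos u a j                             ∎

  ≼-fixed-left : ∀ {i} → i Fin.< a → w ≼ swapPos u i b → w ≼ swapPos u i a → w ≼ swapPos v i b
  ≼-fixed-left {i} i<a w≼uib w≼uia = by-cases (FinP.<-cmp (u ⟨$⟩ʳ i) (u ⟨$⟩ʳ b))
    where
    i≢a : i ≢ a
    i≢a = <⇒≢ i<a
    i≢b : i ≢ b
    i≢b = <⇒≢ (ℕP.<-trans i<a a<b)
    a≢i : a ≢ i
    a≢i = i≢a ∘ sym
    b≢i : b ≢ i
    b≢i = i≢b ∘ sym
    b≢a : b ≢ a
    b≢a = a≢b ∘ sym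
    z : Perm n
    z = swapPos v i b
    z≈uia-ab : z ≈ swapPos (swapPos u i a) a b
    z≈uia-ab = swapPos-conjugate u (transpose-other i≢a i≢b) (transpose-snd a b)
    by-cases : Tri (u ⟨$⟩ʳ i Fin.< u ⟨$⟩ʳ b) (u ⟨$⟩ʳ i ≡ u ⟨$⟩ʳ b) (u ⟨$⟩ʳ b Fin.< u ⟨$⟩ʳ i) → w ≼ z
    by-cases (tri< ui<ub _ _) =
      ≼-respʳ-≈ (≼-swapPos-ascent w≼uia a<b (subst₂ Fin._<_ (sym (swapPos-snd u i a)) (sym (swapPos-other u b≢i b≢a)) ui<ub))
                (λ k → sym (z≈uia-ab k))
    by-cases (tri≈ _ ui≡ub _) = contradiction (⟨$⟩ʳ-injective u ui≡ub) i≢b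
    by-cases (tri> _ _ ub<ui) = ≼-unswap i<a a<b
      (subst₂ Fin._<_ (sym z-i) (sym z-a) ua<ub) (subst₂ Fin._<_ (sym z-a) (sym z-b) ub<ui)
      (≼-respʳ-≈ w≼uib (λ k → sym (z-ia k))) (≼-respʳ-≈ w≼uia (λ k → sym (z-ab k)))
      where
      open ≈-Reasoning
      z-i : z ⟨$⟩ʳ i ≡ u ⟨$⟩ʳ a
      z-i = trans (swapPos-fst v i b) (swapPos-snd u a b)
      z-a : z ⟨$⟩ʳ a ≡ u ⟨$⟩ʳ b
      z-a = trans (swapPos-other v a≢i a≢b) (swapPos-fst u a b)
      z-b : z ⟨$⟩ʳ b ≡ u ⟨$⟩ʳ i
      z-b = trans (swapPos-snd v i b) (swapPos-other u i≢a i≢b)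
      z-ia : swapPos z i a ≈ swapPos u i b
      z-ia = begin
        swapPos z i a                             ≈⟨ swapPos-cong {x = z} {swapPos (swapPos u i b) a i}
                                                       (swapPos-conjugate′ u (transpose-other a≢i a≢b) (transpose-snd i b)) i a ⟩
        swapPos (swapPos (swapPos u i b) a i) i a ≈⟨ swapPos-cong {x = swapPos (swapPos u i b) a i} {swapPos (swapPos u i b) i a}
                                                       (swapPos-sym (swapPos u i b) a i) i a ⟩
        swapPos (swapPos (swapPos u i b) i a) i a ≈⟨ swapPos-involutive (swapPos u i b) i a ⟩
        swapPos u i b                             ∎
      z-ab : swapPos z a b ≈ swapPos u i a
      z-ab = begin
        swapPos z a b                             ≈⟨ swapPos-cong {x = z} {swapPos (swapPos u i a) a b} z≈uia-ab a b ⟩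
        swapPos (swapPos (swapPos u i a) a b) a b ≈⟨ swapPos-involutive (swapPos u i a) a b ⟩
        swapPos u i a                             ∎

  ≼-fixed : ∀ {i j} → i Fin.< j → w ≼ swapPos u i j →
            (i ≡ a → b Fin.< j → ¬ ¬ w ≼ swapPos u b j) → (i Fin.< a → j ≡ b → ¬ ¬ w ≼ swapPos u i a) →
            w ≼ swapPos v i j
  ≼-fixed {i} {j} i<j w≼uij right-partner left-partner with FinP.<-cmp (PC.transpose i j a) (PC.transpose i j b)
  ... | tri< σa<σb _ _ = ≼-fixed-order-preserved w≼uij σa<σb
  ... | tri≈ _ σa≡σb _ = contradiction (transpose-injective i j σa≡σb) a≢b
  ... | tri> _ _ σb<σa with transpose-reverses i<j a<b σb<σa
  ...   | inj₁ (refl , refl)       = ≼-fixed-ab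
  ...   | inj₂ (inj₁ (refl , b<j)) = ≼-fixed-right b<j w≼uij (≼-stable (right-partner refl b<j))
  ...   | inj₂ (inj₂ (i<a , refl)) = ≼-fixed-left i<a w≼uij (≼-stable (left-partner i<a refl))

Φ-into-E : {h : Fin n → Fin n} {w u v : Perm n} {a b : Fin n} → IsHessenberg h → w ≼ u →
           a Fin.< b → u ⟨$⟩ʳ a Fin.< u ⟨$⟩ʳ b → v ≈ swapPos u a b →
           ∀ p q → E w h u p → Φ w h u a b p q → E w h v q
Φ-into-E {h = h} {w} {u} {v} {a} {b} hessenberg w≼u a<b ua<ub v≈ = into
  where
  open Exchange w≼u a<b ua<ub using (≼-moved-right; ≼-moved-left; ≼-fixed)
  onto-v : ∀ {i j} → w ≼ swapPos (swapPos u a b) i j → w ≼ swapPos v i j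
  onto-v {i} {j} w≼ = ≼-respʳ-≈ w≼ (swapPos-cong {x = swapPos u a b} {v} (λ k → sym (v≈ k)) i j)
  into : ∀ p q → E w h u p → Φ w h u a b p q → E w h v q
  into _ _ (a<j , j≤ha , w≼uaj) (case₁ b<j _) =
    b<j , ℕP.≤-trans j≤ha (IsHessenberg.monotone hessenberg (ℕP.<⇒≤ a<b)) , onto-v (≼-moved-right b<j w≼uaj)
  into _ _ (i<b , b≤hi , w≼uib) (case₂ i<a _) =
    i<a , ℕP.≤-trans (ℕP.<⇒≤ a<b) b≤hi , onto-v (≼-moved-left i<a w≼uib)
  into _ _ (i<j , j≤hi , w≼uij) (case₃ not-right not-left) =
    i<j , j≤hi , onto-v (≼-fixed i<j w≼uij (λ i≡a b<j ∉E → not-right (i≡a , b<j , ∉E ∘ proj₂ ∘ proj₂))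
                                          (λ i<a j≡b ∉E → not-left (i<a , j≡b , ∉E ∘ proj₂ ∘ proj₂)))

Φ-injective : {h : Fin n → Fin n} {w u : Perm n} {a b : Fin n} → a Fin.< b →
              ∀ p p′ q → E w h u p → E w h u p′ → Φ w h u a b p q → Φ w h u a b p′ q → p ≡ p′
Φ-injective _   _ _ _ _  _  (case₁ _ _)   (case₁ _ _)   = refl
Φ-injective a<b _ _ _ _  _  (case₁ _ _)   (case₂ i<a _) = contradiction i<a (ℕP.<-asym a<b)
Φ-injective _   _ _ _ _  p′ (case₁ _ ∉E)  (case₃ _ _)   = contradiction p′ ∉E
Φ-injective a<b _ _ _ _  _  (case₂ i<a _) (case₁ _ _)   = contradiction i<a (ℕP.<-asym a<b)
Φ-injective _   _ _ _ _  _  (case₂ _ _)   (case₂ _ _)   = refl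
Φ-injective _   _ _ _ _  p′ (case₂ _ ∉E)  (case₃ _ _)   = contradiction p′ ∉E
Φ-injective _   _ _ _ p  _  (case₃ _ _)   (case₁ _ ∉E)  = contradiction p ∉E
Φ-injective _   _ _ _ p  _  (case₃ _ _)   (case₂ _ ∉E)  = contradiction p ∉E
Φ-injective _   _ _ _ _  _  (case₃ _ _)   (case₃ _ _)   = refl

-- Unused: the generator hypothesis, the bounds u, v ≼ w₀, w ≼ v, and b ≤ h(a), w ≼ u(a,b) from E(a,b).
lemma3p6 : (n : ℕ) (h : Fin n → Fin n) → IsHessenberg h →
    (w : Perm n) → IsGenerator h w →
    (u v : Perm n) → InInterval w u → InInterval w v →
    (a b : Fin n) → E w h u (a , b) → v ≈ swapPos u a b → u ≺[ h ] v →
    (∀ p q → E w h u p → Φ w h u a b p q → E w h v q)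
    × (∀ p p′ q → E w h u p → E w h u p′ → Φ w h u a b p q → Φ w h u a b p′ q → p ≡ p′)
lemma3p6 n h hessenberg w _ u v (w≼u , _) _ a b (a<b , _ , _) v≈ u≺v =
  Φ-into-E {h = h} {w} {u} {v} hessenberg w≼u a<b ua<ub v≈ , Φ-injective {h = h} {w} {u} a<b
  where
  ua<ub : u ⟨$⟩ʳ a Fin.< u ⟨$⟩ʳ b
  ua<ub = ascent-of-len-swapPos u a<b (subst (len u ℕ.<_) (len-cong {x = v} {swapPos u a b} v≈) (≺[]⇒len< u≺v))
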